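{- Let $H$ be a connected $4$-uniform hypergraph of order $8$ with at least $4$ hyperedges. Then one of the following holds: (i) the diameter of $H$ is at most $2$ and $W(H)\le 40$; (ii) the diameter of $H$ is $3$, $W(H)\le 41$, and $H$ has exactly one unordered pair of vertices at distance $3$; (iii) the diameter of $H$ is $3$, $40\le W(H)\le 42$, and $H$ has exactly two unordered pairs of vertices at distance $3$.
   Context: A hypergraph $H=(V,E)$ consists of a finite vertex set $V$ and a set $E$ of distinct subsets of $V$ (hyperedges); it is $4$-uniform if every hyperedge has exactly $4$ elements; its order is $|V|$. For $u,w\in V$, $d_H(u,w)$ is the least $\ell\ge0$ such that there are vertices $u=x_0,\dots,x_\ell=w$ with $x_{i-1},x_i$ in a common hyperedge for each $i$ ($\infty$ if none); $H$ is connected if all distances are finite; its diameter is $\max_{u,w}d_H(u,w)$. The Wiener index is $W(H)=\sum_{\{u,w\}\subseteq V,\,u\ne w} d_H(u,w)$. -}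

module Defs where

open import Data.Nat using (ℕ; zero; suc; _+_; _≤_; _<_; _⊔_)
open import Data.Fin using (Fin; toℕ)
open import Data.Fin.Subset using (Subset; _∈_; ∣_∣)
open import Data.Nat.ListAction using (sum)
open import Data.List using (List; []; _∷_; length; map; filter; concatMap; allFin; foldr)
open import Data.List.Membership.Propositional renaming (_∈_ to _∈ₗ_)
open import Data.List.Relation.Unary.All using (All)
open import Data.List.Relation.Unary.Unique.Propositional using (Unique)
open import Data.Product using (Σ; ∃; _×_; _,_)
open import Relation.Binary.PropositionalEquality using (_≡_)
open import Relation.Nullary.Decidable using (⌊_⌋)
open import Data.Nat.Properties using (_≟_)
open import Data.Fin.Properties using () renaming (_<?_ to _<?ᶠ_)

record Hypergraph (n : ℕ) : Set where
  field
    edges    : List (Subset n)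
    distinct : Unique edges
open Hypergraph public

numEdges : ∀ {n} → Hypergraph n → ℕ
numEdges H = length (edges H)

Uniform : ∀ {n} → ℕ → Hypergraph n → Set
Uniform k H = All (λ e → ∣ e ∣ ≡ k) (edges H)

Adj : ∀ {n} → Hypergraph n → Fin n → Fin n → Set
Adj H x y = Σ (Subset _) λ e → (e ∈ₗ edges H) × (x ∈ e) × (y ∈ e)

data Walk {n : ℕ} (H : Hypergraph n) : Fin n → Fin n → ℕ → Set where
  here : ∀ {u} → Walk H u u zero
  step : ∀ {u v w ℓ} → Adj H u v → Walk H v w ℓ → Walk H u w (suc ℓ)

Connected : ∀ {n} → Hypergraph n → Set
Connected H = ∀ u w → ∃ λ ℓ → Walk H u w ℓ

IsDistance : ∀ {n} → Hypergraph n → (Fin n → Fin n → ℕ) → Set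
IsDistance H d = ∀ u w → Walk H u w (d u w) × (∀ ℓ → Walk H u w ℓ → d u w ≤ ℓ)

pairs : (n : ℕ) → List (Fin n × Fin n)
pairs n = concatMap (λ u → map (λ w → u , w)
            (filter (λ w → u <?ᶠ w) (allFin n))) (allFin n)

wiener : ∀ {n} → (Fin n → Fin n → ℕ) → ℕ
wiener {n} d = sum (map (λ { (u , w) → d u w }) (pairs n))

diameter : ∀ {n} → (Fin n → Fin n → ℕ) → ℕ
diameter {n} d = foldr _⊔_ 0 (map (λ { (u , w) → d u w }) (pairs n))

pairsAt : ∀ {n} → (Fin n → Fin n → ℕ) → ℕ → ℕ
pairsAt {n} d k = length (filter (λ { (u , w) → d u w ≟ k }) (pairs n))

-- Distinct vertices are at distance 1, 2 or 3: two disjoint edges are complementary 4-sets, and a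
-- third edge (there are at least four) meets both. Writing cₖ for the number of pairs at distance k,
-- W = 2·28 − c₁ + c₃, so it suffices to show c₁ ≥ 16, c₃ ≤ 2, and c₁ ≤ 18 when c₃ = 2.
--
-- c₁ ≥ 16: grow a family of edges; an edge with m vertices outside the family adds at least
-- 6 − C(4 − m, 2) covered pairs. Starting from two distinct, non-complementary edges this reaches 16,
-- except when two edges cover exactly 7 vertices; then the pairs of an edge R through the missing
-- vertex z, together with one pair of a fourth edge, make up the difference.
--
-- c₃: if d(u, w) = 3, the edges A ∋ u and B ∋ w are complementary, and both ends of every pair at
-- distance 3 lie in no edge other than A and B. Two further edges cover at least 5 vertices, so the
-- set T of such vertices has at most 3 elements. A check over all A and T bounds the pairs inside T
-- separated by A by 2, and, when there are 2 of them, the pairs inside A, inside ∁ A or outside T,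
-- which include all adjacent pairs, by 18.
module Submission where

open import Defs
open import Data.Nat using (ℕ; zero; suc; _+_; _∸_; _≤_; _<_; _⊔_; z≤n; s≤s; s≤s⁻¹; _≤?_)
open import Data.Nat.Properties
  using (suc-injective; ≤-refl; ≤-trans; ≤-reflexive; ≤-antisym; <-irrefl; <-≤-trans; ≤∧≢⇒<; ≰⇒>; n≤1+n; m≤n⇒m≤1+n; m≤m+n;
         +-suc; +-comm; +-mono-≤; +-monoˡ-≤; +-monoʳ-≤; +-cancelˡ-≡; +-cancelˡ-≤; +-cancelʳ-≤; ∸-monoʳ-≤;
         m≤m⊔n; m≤n⊔m; ⊔-lub; module ≤-Reasoning)
  renaming (_≟_ to _≟ℕ_)
open import Data.Nat.ListAction using (sum)
open import Data.Bool using (true)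
import Data.Bool.Properties as Bool
open import Data.Fin using (Fin; zero; suc; punchIn) renaming (_<_ to _<ᶠ_)
open import Data.Fin.Properties using (all?; ¬∀⟶∃¬; <-cmp; <⇒≢; punchInᵢ≢i) renaming (_<?_ to _<?ᶠ_; _≟_ to _≟ᶠ_)
open import Data.Fin.Subset
  using (Subset; inside; outside; _∈_; _∉_; _⊆_; _∪_; _∩_; _─_; ∁; ∣_∣; ⋃; Nonempty; Empty)
open import Data.Fin.Subset.Properties
  using (_∈?_; _⊆?_; nonempty?; x∈p∪q⁺; x∈p∪q⁻; x∈p∩q⁺; x∈p∩q⁻; x∈p∧x∉q⇒x∈p─q; x∉p⇒x∈∁p; p─q⊆p; p─⊥≡p;
         ∪-identityʳ; ∣⁅x⁆∣≡1; x∈⁅y⁆⇒x≡y; p⊆q⇒∣p∣≤∣q∣; ⊆-antisym; ⊆⊤; ∣⊤∣≡n; ∣p∣≤n; ∣∁p∣≡n∸∣p∣)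
open import Data.Vec using (_∷_; []; tabulate)
import Data.Vec as Vec
open import Data.Vec.Properties using (≡-dec; lookup⇒[]=; []=⇒lookup; lookup∘tabulate)
open import Data.List using (List; []; _∷_; length; filter; map; foldr; allFin; _++_)
open import Data.List.Properties using (filter-some; filter-notAll)
open import Data.List.Relation.Unary.All using (All; []; _∷_)
import Data.List.Relation.Unary.All as All
open import Data.List.Relation.Unary.Any using (Any; here; there; any?)
import Data.List.Relation.Unary.Any as Any
open import Data.List.Relation.Unary.Unique.Propositional using (Unique; _∷_)
open import Data.List.Membership.Propositional using (lose; find) renaming (_∈_ to _∈ₗ_; _∉_ to _∉ₗ_)
open import Data.List.Membership.Propositional.Properties
  using (∈-concatMap⁺; ∈-concatMap⁻; ∈-map⁺; ∈-map⁻; ∈-filter⁺; ∈-filter⁻; ∈-allFin)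
open import Data.Product using (∃; ∃₂; _×_; _,_; proj₁; proj₂)
import Data.Product as Product
open import Data.Sum using (_⊎_; inj₁; inj₂)
import Data.Sum as Sum
open import Function using (_∘_)
open import Level using (0ℓ)
open import Relation.Binary.Definitions using (DecidableEquality; tri<; tri≈; tri>)
open import Relation.Binary.PropositionalEquality using (_≡_; _≢_; refl; sym; trans; cong; cong₂; subst)
open import Relation.Nullary using (Dec; yes; no; ¬_; ¬?; does; contradiction)
open import Relation.Nullary.Decidable using (dec-true; map′; _→-dec_; _×-dec_; _⊎-dec_)
open import Relation.Unary using (Pred; Decidable) renaming (∁ to ∁ᵘ)
open import Relation.Unary.Properties using (_∪?_)

allSubsets? : ∀ {n} {P : Pred (Subset n) 0ℓ} → Decidable P → Dec (∀ p → P p)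
allSubsets? {zero}  P? = map′ (λ { h [] → h }) (λ h → h []) (P? [])
allSubsets? {suc n} P? =
  map′ (λ { (i , o) (inside ∷ p) → i p ; (i , o) (outside ∷ p) → o p })
       (λ h → (λ p → h (inside ∷ p)) , (λ p → h (outside ∷ p)))
       (allSubsets? (P? ∘ (inside ∷_)) ×-dec allSubsets? (P? ∘ (outside ∷_)))

allSubsetsOfSize? : ∀ {n} k {P : Pred (Subset n) 0ℓ} → Decidable P → Dec (∀ p → ∣ p ∣ ≡ k → P p)
allSubsetsOfSize? {zero}  zero    P? = map′ (λ { h [] _ → h }) (λ h → h [] refl) (P? [])
allSubsetsOfSize? {zero}  (suc k) P? = yes λ { [] () }
allSubsetsOfSize? {suc n} zero    P? =
  map′ (λ { h (outside ∷ p) e → h p e ; h (inside ∷ p) () })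
       (λ h p → h (outside ∷ p))
       (allSubsetsOfSize? zero (P? ∘ (outside ∷_)))
allSubsetsOfSize? {suc n} (suc k) P? =
  map′ (λ { (i , o) (inside ∷ p) e → i p (suc-injective e) ; (i , o) (outside ∷ p) e → o p e })
       (λ h → (λ p e → h (inside ∷ p) (cong suc e)) , (λ p → h (outside ∷ p)))
       (allSubsetsOfSize? k (P? ∘ (inside ∷_)) ×-dec allSubsetsOfSize? (suc k) (P? ∘ (outside ∷_)))

infix 4 _≟ˢ_
_≟ˢ_ : ∀ {n} → DecidableEquality (Subset n)
_≟ˢ_ = ≡-dec Bool._≟_

-- Agda checks `refl : does a? ≡ true` several times faster than `tt : True a?`.
by-decision : ∀ {A : Set} (a? : Dec A) → does a? ≡ true → A
by-decision (yes a) _ = a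

∣p∪q∣≡∣q∣+∣p─q∣ : ∀ {n} (p q : Subset n) → ∣ p ∪ q ∣ ≡ ∣ q ∣ + ∣ p ─ q ∣
∣p∪q∣≡∣q∣+∣p─q∣ []            []            = refl
∣p∪q∣≡∣q∣+∣p─q∣ (inside  ∷ p) (inside  ∷ q) = cong suc (∣p∪q∣≡∣q∣+∣p─q∣ p q)
∣p∪q∣≡∣q∣+∣p─q∣ (outside ∷ p) (inside  ∷ q) = cong suc (∣p∪q∣≡∣q∣+∣p─q∣ p q)
∣p∪q∣≡∣q∣+∣p─q∣ (inside  ∷ p) (outside ∷ q) = trans (cong suc (∣p∪q∣≡∣q∣+∣p─q∣ p q)) (sym (+-suc _ _))
∣p∪q∣≡∣q∣+∣p─q∣ (outside ∷ p) (outside ∷ q) = ∣p∪q∣≡∣q∣+∣p─q∣ p q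

Nonempty⇒1≤∣p∣ : ∀ {n} {p : Subset n} → Nonempty p → 1 ≤ ∣ p ∣
Nonempty⇒1≤∣p∣ {p = p} (x , x∈p) =
  subst (_≤ ∣ p ∣) (∣⁅x⁆∣≡1 x) (p⊆q⇒∣p∣≤∣q∣ λ y∈⁅x⁆ → subst (_∈ p) (sym (x∈⁅y⁆⇒x≡y x y∈⁅x⁆)) x∈p)

∣p∣<n⇒∃∉ : ∀ {n} {p : Subset n} → ∣ p ∣ < n → ∃ λ x → x ∉ p
∣p∣<n⇒∃∉ {n} {p} ∣p∣<n = ¬∀⟶∃¬ n (_∈ p) (_∈? p) λ all∈p →
  <-irrefl (trans (cong ∣_∣ (⊆-antisym ⊆⊤ λ {x} _ → all∈p x)) (∣⊤∣≡n n)) ∣p∣<n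

x∈p─q⇒x∉q : ∀ {n} {x : Fin n} (p q : Subset n) → x ∈ p ─ q → x ∉ q
x∈p─q⇒x∉q (inside  ∷ p) (outside ∷ q) Vec.here       ()
x∈p─q⇒x∉q (outside ∷ p) (outside ∷ q) (Vec.there x∈) (Vec.there x∈q) = x∈p─q⇒x∉q p q x∈ x∈q
x∈p─q⇒x∉q (inside  ∷ p) (outside ∷ q) (Vec.there x∈) (Vec.there x∈q) = x∈p─q⇒x∉q p q x∈ x∈q
x∈p─q⇒x∉q (_       ∷ p) (inside  ∷ q) (Vec.there x∈) (Vec.there x∈q) = x∈p─q⇒x∉q p q x∈ x∈q

─-antimonoʳ : ∀ {n} {p q r : Subset n} → q ⊆ r → p ─ r ⊆ p ─ q
─-antimonoʳ {p = p} {r = r} q⊆r x∈p─r =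
  x∈p∧x∉q⇒x∈p─q (p─q⊆p p r x∈p─r) (x∈p─q⇒x∉q p r x∈p─r ∘ q⊆r)

Empty-∩-comm : ∀ {n} {p q : Subset n} → Empty (p ∩ q) → Empty (q ∩ p)
Empty-∩-comm {p = p} {q} empty (x , x∈q∩p) = empty (x , x∈p∩q⁺ (Product.swap (x∈p∩q⁻ q p x∈q∩p)))

∈⋃⁺ : ∀ {n} {x : Fin n} {E F} → x ∈ E → E ∈ₗ F → x ∈ ⋃ F
∈⋃⁺ x∈E (here refl) = x∈p∪q⁺ (inj₁ x∈E)
∈⋃⁺ x∈E (there E∈F) = x∈p∪q⁺ (inj₂ (∈⋃⁺ x∈E E∈F))

subsetOf : ∀ {n} {P : Pred (Fin n) 0ℓ} → Decidable P → Subset n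
subsetOf P? = tabulate (does ∘ P?)

∈-subsetOf⁺ : ∀ {n} {P : Pred (Fin n) 0ℓ} (P? : Decidable P) {x} → P x → x ∈ subsetOf P?
∈-subsetOf⁺ P? {x} Px = lookup⇒[]= x _ (trans (lookup∘tabulate _ x) (dec-true (P? x) Px))

∈-subsetOf⁻ : ∀ {n} {P : Pred (Fin n) 0ℓ} (P? : Decidable P) {x} → x ∈ subsetOf P? → P x
∈-subsetOf⁻ P? {x} x∈ with P? x | trans (sym (lookup∘tabulate (does ∘ P?) x)) ([]=⇒lookup x∈)
... | yes Px | _  = Px
... | no  _  | ()

Unique⇒∃∉ : ∀ {A : Set} → DecidableEquality A → ∀ {xs ys : List A} → Unique xs → length ys < length xs →
            ∃ λ x → x ∈ₗ xs × x ∉ₗ ys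
Unique⇒∃∉ _≟_ {x ∷ xs} {ys} (x≢xs ∷ unique) ys<xs with any? (x ≟_) ys
... | no x∉ys  = x , here refl , x∉ys
... | yes x∈ys =
  let y , y∈xs , y∉ys⁻ = Unique⇒∃∉ _≟_ unique fewer
  in  y , there y∈xs , λ y∈ys → y∉ys⁻ (∈-filter⁺ _ y∈ys (All.lookup x≢xs y∈xs ∘ sym))
  where
  fewer : length (filter (λ y → ¬? (y ≟ x)) ys) < length xs
  fewer = <-≤-trans (filter-notAll _ ys (Any.map (λ { refl y≢x → y≢x refl }) x∈ys)) (s≤s⁻¹ ys<xs)

module _ {A : Set} (f : A → ℕ) where

  foldr-⊔-lub : ∀ {k xs} → All (λ x → f x ≤ k) xs → foldr _⊔_ 0 (map f xs) ≤ k
  foldr-⊔-lub []       = z≤n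
  foldr-⊔-lub (h ∷ hs) = ⊔-lub h (foldr-⊔-lub hs)

  foldr-⊔-upper : ∀ {x xs} → x ∈ₗ xs → f x ≤ foldr _⊔_ 0 (map f xs)
  foldr-⊔-upper {xs = y ∷ _} (here refl) = m≤m⊔n (f y) _
  foldr-⊔-upper {xs = y ∷ _} (there x∈)  = ≤-trans (foldr-⊔-upper x∈) (m≤n⊔m (f y) _)

count : ∀ {A : Set} {P : Pred A 0ℓ} → Decidable P → List A → ℕ
count P? xs = length (filter P? xs)

module _ {A : Set} {P Q : Pred A 0ℓ} (P? : Decidable P) (Q? : Decidable Q) where

  count-mono : ∀ {xs} → (∀ {x} → x ∈ₗ xs → P x → Q x) → count P? xs ≤ count Q? xs
  count-mono {[]}     _ = z≤n
  count-mono {x ∷ xs} h with P? x | Q? x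
  ... | yes _  | yes _  = s≤s (count-mono (h ∘ there))
  ... | yes Px | no ¬Qx = contradiction (h (here refl) Px) ¬Qx
  ... | no _   | yes _  = m≤n⇒m≤1+n (count-mono (h ∘ there))
  ... | no _   | no _   = count-mono (h ∘ there)

  count-∪ : (∀ {x} → P x → ¬ Q x) → ∀ xs → count P? xs + count Q? xs ≡ count (P? ∪? Q?) xs
  count-∪ disjoint []       = refl
  count-∪ disjoint (x ∷ xs) with P? x | Q? x
  ... | yes Px | yes Qx = contradiction Qx (disjoint Px)
  ... | yes _  | no _   = cong suc (count-∪ disjoint xs)
  ... | no _   | yes _  = trans (+-suc _ _) (cong suc (count-∪ disjoint xs))
  ... | no _   | no _   = count-∪ disjoint xs

module _ {A : Set} {P : Pred A 0ℓ} (P? : Decidable P) where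

  1≤count⇒Any : ∀ xs → 1 ≤ count P? xs → Any P xs
  1≤count⇒Any (x ∷ xs) 1≤c with P? x
  ... | yes Px = here Px
  ... | no _   = there (1≤count⇒Any xs 1≤c)

  count≡0⇒All∁ : ∀ xs → count P? xs ≡ 0 → All (∁ᵘ P) xs
  count≡0⇒All∁ []       _   = []
  count≡0⇒All∁ (x ∷ xs) c≡0 with P? x
  ... | no ¬Px = ¬Px ∷ count≡0⇒All∁ xs c≡0

sum-of-values-in-1…3 : ∀ {A : Set} (f : A → ℕ) {xs} → All (λ x → 1 ≤ f x × f x ≤ 3) xs →
  sum (map f xs) + count (λ x → f x ≟ℕ 1) xs ≡ length xs + length xs + count (λ x → f x ≟ℕ 3) xs
sum-of-values-in-1…3 f {[]}     []               = refl
sum-of-values-in-1…3 f {x ∷ xs} (_ ∷ hs) with f x | sum-of-values-in-1…3 f hs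
... | 1 | ih = cong suc (trans (+-suc (sum (map f xs)) _) (trans (cong suc ih) (cong (_+ c₃) (sym (+-suc n n)))))
  where n = length xs; c₃ = count (λ x → f x ≟ℕ 3) xs
... | 2 | ih = cong suc (trans (cong suc ih) (cong (_+ c₃) (sym (+-suc n n))))
  where n = length xs; c₃ = count (λ x → f x ≟ℕ 3) xs
... | 3 | ih = cong suc (trans (cong (2 +_) ih)
                     (sym (trans (+-suc (n + suc n) c₃) (cong (λ k → suc (k + c₃)) (+-suc n n)))))
  where n = length xs; c₃ = count (λ x → f x ≟ℕ 3) xs
sum-of-values-in-1…3 f {x ∷ xs} ((() , _) ∷ _) | 0 | _
sum-of-values-in-1…3 f {x ∷ xs} ((_ , s≤s (s≤s (s≤s ()))) ∷ _) | suc (suc (suc (suc _))) | _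

Pair : ℕ → Set
Pair n = Fin n × Fin n

∈-pairs⁺ : ∀ {n} {u w : Fin n} → u <ᶠ w → (u , w) ∈ₗ pairs n
∈-pairs⁺ {n} {u} u<w =
  ∈-concatMap⁺ _ (Any.map (λ { refl → ∈-map⁺ _ (∈-filter⁺ (u <?ᶠ_) (∈-allFin _) u<w) }) (∈-allFin {n} u))

∈-pairs⁻ : ∀ {n} {u w : Fin n} → (u , w) ∈ₗ pairs n → u <ᶠ w
∈-pairs⁻ {n} uw∈ with Any.satisfied (∈-concatMap⁻ _ {xs = allFin n} uw∈)
... | v , uw∈v with ∈-map⁻ _ uw∈v
... | w , w∈ , refl = proj₂ (∈-filter⁻ (v <?ᶠ_) {xs = allFin n} w∈)

∈-pairs-ordered : ∀ {n} {u w : Fin n} → u ≢ w → (u , w) ∈ₗ pairs n ⊎ (w , u) ∈ₗ pairs n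
∈-pairs-ordered {u = u} {w} u≢w with <-cmp u w
... | tri< u<w _ _ = inj₁ (∈-pairs⁺ u<w)
... | tri≈ _ u≡w _ = contradiction u≡w u≢w
... | tri> _ _ w<u = inj₂ (∈-pairs⁺ w<u)

-- The list `pairs n` again, in the same order; unlike `pairs 8` it is cheap to evaluate, so the
-- exhaustive checks count over `pairs′ 8` while their statements mention `pairs 8`.
pairs′ : ∀ n → List (Pair n)
pairs′ zero    = []
pairs′ (suc n) = map (zero ,_) (map suc (allFin n)) ++ map (Product.map suc suc) (pairs′ n)

infix 4 _⊆ᵖ_ _⊆ᵖ?_ _∈ᵖ_ _∈ᵖ?_

_⊆ᵖ_ : ∀ {n} → Pair n → Subset n → Set
(u , w) ⊆ᵖ S = u ∈ S × w ∈ S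

_⊆ᵖ?_ : ∀ {n} (p : Pair n) (S : Subset n) → Dec (p ⊆ᵖ S)
(u , w) ⊆ᵖ? S = (u ∈? S) ×-dec (w ∈? S)

_∈ᵖ_ : ∀ {n} → Fin n → Pair n → Set
z ∈ᵖ (u , w) = u ≡ z ⊎ w ≡ z

_∈ᵖ?_ : ∀ {n} (z : Fin n) (p : Pair n) → Dec (z ∈ᵖ p)
z ∈ᵖ? (u , w) = (u ≟ᶠ z) ⊎-dec (w ≟ᶠ z)

∉⊎∉⇒¬⊆ᵖ : ∀ {n} {a b : Fin n} {S} → a ∉ S ⊎ b ∉ S → ¬ (a , b) ⊆ᵖ S
∉⊎∉⇒¬⊆ᵖ (inj₁ a∉S) (a∈S , _) = a∉S a∈S
∉⊎∉⇒¬⊆ᵖ (inj₂ b∉S) (_ , b∈S) = b∉S b∈S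

Meets : ∀ {n} → Subset n → Pred (Pair n) 0ℓ
Meets M (u , w) = u ∈ M ⊎ w ∈ M

meets? : ∀ {n} (M : Subset n) → Decidable (Meets M)
meets? M (u , w) = (u ∈? M) ⊎-dec (w ∈? M)

Split : ∀ {n} → Subset n → Pred (Pair n) 0ℓ
Split A (u , w) = u ∈ A × w ∈ ∁ A ⊎ u ∈ ∁ A × w ∈ A

split? : ∀ {n} (A : Subset n) → Decidable (Split A)
split? A (u , w) = ((u ∈? A) ×-dec (w ∈? ∁ A)) ⊎-dec ((u ∈? ∁ A) ×-dec (w ∈? A))

Covered : ∀ {n} → List (Subset n) → Pred (Pair n) 0ℓ
Covered F p = Any (p ⊆ᵖ_) F

covered? : ∀ {n} (F : List (Subset n)) → Decidable (Covered F)
covered? F p = any? (p ⊆ᵖ?_) F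

Covered⇒⊆ᵖ⋃ : ∀ {n} {F : List (Subset n)} {p} → Covered F p → p ⊆ᵖ ⋃ F
Covered⇒⊆ᵖ⋃ covered with find covered
... | E , E∈F , u∈E , w∈E = ∈⋃⁺ u∈E E∈F , ∈⋃⁺ w∈E E∈F

#Covered : List (Subset 8) → ℕ
#Covered F = count (covered? F) (pairs 8)

-- 4-subsets of an 8-set

-- 6 ∸ C(4 ∸ m, 2): the number of pairs of a 4-set that meet m given elements of it.
φ : ℕ → ℕ
φ 0 = 0
φ 1 = 3
φ 2 = 5
φ _ = 6

3≤φ : ∀ {m} → 1 ≤ m → 3 ≤ φ m
3≤φ {1}                 _ = ≤-refl
3≤φ {2}                 _ = m≤m+n 3 2
3≤φ {suc (suc (suc _))} _ = m≤m+n 3 3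

5≤φ : ∀ {m} → 2 ≤ m → 5 ≤ φ m
5≤φ {1}                 (s≤s ())
5≤φ {2}                 _ = ≤-refl
5≤φ {suc (suc (suc _))} _ = m≤m+n 5 1

-- Opaque, so that using these facts never unfolds the decision procedures behind them.
module _ (X : Subset 8) (∣X∣≡4 : ∣ X ∣ ≡ 4) (Y : Subset 8) (∣Y∣≡4 : ∣ Y ∣ ≡ 4) where

  opaque

    distinct⇒Nonempty─ : Y ≢ X → Nonempty (Y ─ X)
    distinct⇒Nonempty─ = by-decision
      (allSubsetsOfSize? 4 λ X → allSubsetsOfSize? 4 λ Y → ¬? (Y ≟ˢ X) →-dec nonempty? (Y ─ X)) refl X ∣X∣≡4 Y ∣Y∣≡4

    Empty∩⇒≡∁ : Empty (X ∩ Y) → Y ≡ ∁ X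
    Empty∩⇒≡∁ = by-decision
      (allSubsetsOfSize? 4 λ X → allSubsetsOfSize? 4 λ Y → ¬? (nonempty? (X ∩ Y)) →-dec (Y ≟ˢ ∁ X)) refl X ∣X∣≡4 Y ∣Y∣≡4

    ∣∪∣≡8⇒≡∁ : ∣ Y ∪ X ∣ ≡ 8 → Y ≡ ∁ X
    ∣∪∣≡8⇒≡∁ = by-decision
      (allSubsetsOfSize? 4 λ X → allSubsetsOfSize? 4 λ Y → (∣ Y ∪ X ∣ ≟ℕ 8) →-dec (Y ≟ˢ ∁ X)) refl X ∣X∣≡4 Y ∣Y∣≡4

    ∣∪∣≡5⇒∣∁∪∣≡7 : ∣ Y ∪ X ∣ ≡ 5 → ∣ ∁ X ∪ Y ∣ ≡ 7
    ∣∪∣≡5⇒∣∁∪∣≡7 = by-decision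
      (allSubsetsOfSize? 4 λ X → allSubsetsOfSize? 4 λ Y → (∣ Y ∪ X ∣ ≟ℕ 5) →-dec (∣ ∁ X ∪ Y ∣ ≟ℕ 7)) refl X ∣X∣≡4 Y ∣Y∣≡4

opaque

  φ≤meeting-pairs : (Z : Subset 8) → ∣ Z ∣ ≡ 4 → (M : Subset 8) → M ⊆ Z →
                    φ ∣ M ∣ ≤ count (λ p → (p ⊆ᵖ? Z) ×-dec meets? M p) (pairs 8)
  φ≤meeting-pairs = by-decision (allSubsetsOfSize? 4 λ Z → allSubsets? λ M →
    M ⊆? Z →-dec (φ ∣ M ∣ ≤? count (λ p → (p ⊆ᵖ? Z) ×-dec meets? M p) (pairs′ 8))) refl

  3≤pairs-through : (R : Subset 8) → ∣ R ∣ ≡ 4 → (z : Fin 8) → z ∈ R →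
                    3 ≤ count (λ p → (p ⊆ᵖ? R) ×-dec z ∈ᵖ? p) (pairs 8)
  3≤pairs-through = by-decision (allSubsetsOfSize? 4 λ R → all? λ z →
    z ∈? R →-dec (3 ≤? count (λ p → (p ⊆ᵖ? R) ×-dec z ∈ᵖ? p) (pairs′ 8))) refl

  split-pairs-bound : (A : Subset 8) → ∣ A ∣ ≡ 4 → (T : Subset 8) → ∣ T ∣ ≤ 3 →
    let split = count (λ p → (p ⊆ᵖ? T) ×-dec split? A p) (pairs 8) in
    split ≤ 2 × (2 ≤ split → count (λ p → (p ⊆ᵖ? A) ⊎-dec (p ⊆ᵖ? ∁ A) ⊎-dec (p ⊆ᵖ? ∁ T)) (pairs 8) ≤ 18)
  split-pairs-bound = by-decision (allSubsetsOfSize? 4 λ A → allSubsets? λ T → ∣ T ∣ ≤? 3 →-dec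
    (let split = count (λ p → (p ⊆ᵖ? T) ×-dec split? A p) (pairs′ 8) in
     split ≤? 2 ×-dec (2 ≤? split →-dec count (λ p → (p ⊆ᵖ? A) ⊎-dec (p ⊆ᵖ? ∁ A) ⊎-dec (p ⊆ᵖ? ∁ T)) (pairs′ 8) ≤? 18))) refl

  ∉-unique-of-∣∣≡7 : (S : Subset 8) → ∣ S ∣ ≡ 7 → (a z : Fin 8) → a ∉ S → z ∉ S → a ≡ z
  ∉-unique-of-∣∣≡7 = by-decision (allSubsetsOfSize? 7 λ S → all? λ a → all? λ z →
    ¬? (a ∈? S) →-dec ¬? (z ∈? S) →-dec (a ≟ᶠ z)) refl

≢∁⇒Nonempty∩ : (X : Subset 8) → ∣ X ∣ ≡ 4 → (Y : Subset 8) → ∣ Y ∣ ≡ 4 → Y ≢ ∁ X → Nonempty (X ∩ Y)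
≢∁⇒Nonempty∩ X ∣X∣≡4 Y ∣Y∣≡4 Y≢∁X with nonempty? (X ∩ Y)
... | yes nonempty = nonempty
... | no  empty    = contradiction (Empty∩⇒≡∁ X ∣X∣≡4 Y ∣Y∣≡4 empty) Y≢∁X

-- If z ∈ D take z and a vertex outside R; otherwise take a vertex outside P and one outside Q,
-- which differ because z is the only vertex outside Q ∪ P.
escaping-pair : ∀ {P Q R D : Subset 8} {z} → ∣ P ∣ ≡ 4 → ∣ Q ∣ ≡ 4 → ∣ R ∣ ≡ 4 → ∣ D ∣ ≡ 4 →
  D ≢ P → D ≢ Q → D ≢ R → ∣ Q ∪ P ∣ ≡ 7 → z ∉ Q ∪ P → z ∈ R →
  ∃₂ λ a b → a ≢ b × (a , b) ⊆ᵖ D × ¬ (a , b) ⊆ᵖ P × ¬ (a , b) ⊆ᵖ Q × ¬ ((a , b) ⊆ᵖ R × z ∈ᵖ (a , b))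
escaping-pair {P} {Q} {R} {D} {z} ∣P∣≡4 ∣Q∣≡4 ∣R∣≡4 ∣D∣≡4 D≢P D≢Q D≢R ∣Q∪P∣≡7 z∉Q∪P z∈R with z ∈? D
... | yes z∈D =
  let b , b∈D─R = distinct⇒Nonempty─ R ∣R∣≡4 D ∣D∣≡4 D≢R
      b∉R = x∈p─q⇒x∉q D R b∈D─R
  in  z , b , (λ { refl → b∉R z∈R }) , (z∈D , p─q⊆p D R b∈D─R) ,
      ∉⊎∉⇒¬⊆ᵖ (inj₁ (z∉Q∪P ∘ x∈p∪q⁺ ∘ inj₂)) , ∉⊎∉⇒¬⊆ᵖ (inj₁ (z∉Q∪P ∘ x∈p∪q⁺ ∘ inj₁)) ,
      ∉⊎∉⇒¬⊆ᵖ (inj₂ b∉R) ∘ proj₁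
... | no z∉D =
  let a , a∈D─P = distinct⇒Nonempty─ P ∣P∣≡4 D ∣D∣≡4 D≢P
      b , b∈D─Q = distinct⇒Nonempty─ Q ∣Q∣≡4 D ∣D∣≡4 D≢Q
      a∈D = p─q⊆p D P a∈D─P
      b∈D = p─q⊆p D Q b∈D─Q
      a∉P = x∈p─q⇒x∉q D P a∈D─P
      b∉Q = x∈p─q⇒x∉q D Q b∈D─Q
      ≢z : ∀ {x} → x ∈ D → x ≢ z
      ≢z x∈D x≡z = z∉D (subst (_∈ D) x≡z x∈D)
      a≢b : a ≢ b
      a≢b a≡b = ≢z a∈D (∉-unique-of-∣∣≡7 (Q ∪ P) ∣Q∪P∣≡7 a z
                  (Sum.[ b∉Q ∘ subst (_∈ Q) a≡b , a∉P ] ∘ x∈p∪q⁻ Q P) z∉Q∪P)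
  in  a , b , a≢b , (a∈D , b∈D) , ∉⊎∉⇒¬⊆ᵖ (inj₁ a∉P) , ∉⊎∉⇒¬⊆ᵖ (inj₂ b∉Q) ,
      λ { (_ , inj₁ a≡z) → ≢z a∈D a≡z ; (_ , inj₂ b≡z) → ≢z b∈D b≡z }

-- Pairs covered by a family of 4-sets

#Covered-∷ : ∀ Z F → ∣ Z ∣ ≡ 4 → #Covered F + φ ∣ Z ─ ⋃ F ∣ ≤ #Covered (Z ∷ F)
#Covered-∷ Z F ∣Z∣≡4 = begin
  #Covered F + φ ∣ Z ─ ⋃ F ∣             ≤⟨ +-monoʳ-≤ (#Covered F) (φ≤meeting-pairs Z ∣Z∣≡4 (Z ─ ⋃ F) (p─q⊆p Z (⋃ F))) ⟩
  #Covered F + count newly? (pairs 8)     ≡⟨ count-∪ (covered? F) newly? disjoint (pairs 8) ⟩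
  count (covered? F ∪? newly?) (pairs 8)  ≤⟨ count-mono (covered? F ∪? newly?) (covered? (Z ∷ F)) {pairs 8} (λ _ → Sum.[ there , here ∘ proj₁ ]) ⟩
  #Covered (Z ∷ F)                        ∎
  where
  open ≤-Reasoning
  newly? : Decidable (λ p → p ⊆ᵖ Z × Meets (Z ─ ⋃ F) p)
  newly? p = (p ⊆ᵖ? Z) ×-dec meets? (Z ─ ⋃ F) p
  disjoint : ∀ {p} → Covered F p → ¬ (p ⊆ᵖ Z × Meets (Z ─ ⋃ F) p)
  disjoint covered (_ , inj₁ u∈Z─⋃F) = x∈p─q⇒x∉q Z (⋃ F) u∈Z─⋃F (proj₁ (Covered⇒⊆ᵖ⋃ covered))
  disjoint covered (_ , inj₂ w∈Z─⋃F) = x∈p─q⇒x∉q Z (⋃ F) w∈Z─⋃F (proj₂ (Covered⇒⊆ᵖ⋃ covered))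

⋃-pair : ∀ (X Y : Subset 8) → ⋃ (Y ∷ X ∷ []) ≡ Y ∪ X
⋃-pair X Y = cong (Y ∪_) (∪-identityʳ X)

#Covered-pair : ∀ {P Q} → ∣ P ∣ ≡ 4 → ∣ Q ∣ ≡ 4 → 6 + φ ∣ Q ─ P ∣ ≤ #Covered (Q ∷ P ∷ [])
#Covered-pair {P} {Q} ∣P∣≡4 ∣Q∣≡4 = begin
  6 + φ ∣ Q ─ P ∣                           ≤⟨ +-monoˡ-≤ (φ ∣ Q ─ P ∣) 6≤#Covered[P] ⟩
  #Covered (P ∷ []) + φ ∣ Q ─ P ∣           ≡⟨ cong (λ U → #Covered (P ∷ []) + φ ∣ Q ─ U ∣) (sym (∪-identityʳ P)) ⟩
  #Covered (P ∷ []) + φ ∣ Q ─ ⋃ (P ∷ []) ∣  ≤⟨ #Covered-∷ Q (P ∷ []) ∣Q∣≡4 ⟩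
  #Covered (Q ∷ P ∷ [])                     ∎
  where
  open ≤-Reasoning
  6≤#Covered[P] : 6 ≤ #Covered (P ∷ [])
  6≤#Covered[P] = subst (λ k → φ k ≤ #Covered (P ∷ [])) (trans (cong ∣_∣ (p─⊥≡p P)) ∣P∣≡4) (#Covered-∷ P [] ∣P∣≡4)

-- Walks and distances

edge-at-start : ∀ {n} {H : Hypergraph n} {u w ℓ} → Walk H u w ℓ → u ≢ w → ∃ λ E → E ∈ₗ edges H × u ∈ E
edge-at-start here                        u≢u = contradiction refl u≢u
edge-at-start (step (E , E∈ , u∈E , _) _) _   = E , E∈ , u∈E

module Distance {n} {H : Hypergraph n} {d : Fin n → Fin n → ℕ} (isDistance : IsDistance H d) where

  d≤length : ∀ {u w ℓ} → Walk H u w ℓ → d u w ≤ ℓ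
  d≤length {u} {w} {ℓ} walk = proj₂ (isDistance u w) ℓ walk

  1≤d : ∀ {u w} → u ≢ w → 1 ≤ d u w
  1≤d {u} {w} u≢w with d u w | proj₁ (isDistance u w)
  ... | zero  | here = contradiction refl u≢w
  ... | suc _ | _    = s≤s z≤n

  d≡1⇒Adj : ∀ {u w} → d u w ≡ 1 → Adj H u w
  d≡1⇒Adj {u} {w} d≡1 with subst (Walk H u w) d≡1 (proj₁ (isDistance u w))
  ... | step adj here = adj

  Adj⇒d≡1 : ∀ {u w} → u ≢ w → Adj H u w → d u w ≡ 1
  Adj⇒d≡1 u≢w adj = ≤-antisym (d≤length (step adj here)) (1≤d u≢w)

module Bounds (H : Hypergraph 8) (connected : Connected H) (uniform : Uniform 4 H) (four : 4 ≤ numEdges H)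
              {d : Fin 8 → Fin 8 → ℕ} (isDistance : IsDistance H d) where

  open Distance isDistance

  Edge : Subset 8 → Set
  Edge E = E ∈ₗ edges H

  ∣edge∣≡4 : ∀ {E} → Edge E → ∣ E ∣ ≡ 4
  ∣edge∣≡4 = All.lookup uniform

  edge-through : (v : Fin 8) → ∃ λ E → Edge E × v ∈ E
  edge-through v = edge-at-start (proj₂ (connected v (punchIn v zero))) (punchInᵢ≢i v zero ∘ sym)

  edge-avoiding : (ys : List (Subset 8)) → length ys < 4 → ∃ λ E → Edge E × E ∉ₗ ys
  edge-avoiding ys ys<4 = Unique⇒∃∉ _≟ˢ_ (distinct H) (<-≤-trans ys<4 four)

  δ : Pair 8 → ℕ
  δ (u , w) = d u w

  edge⇒adjacent : ∀ {p E} → p ∈ₗ pairs 8 → Edge E → p ⊆ᵖ E → δ p ≡ 1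
  edge⇒adjacent {u , w} {E} p∈ E∈ (u∈E , w∈E) = Adj⇒d≡1 (<⇒≢ (∈-pairs⁻ p∈)) (E , E∈ , u∈E , w∈E)

  covered⇒adjacent : ∀ {F p} → All Edge F → p ∈ₗ pairs 8 → Covered F p → δ p ≡ 1
  covered⇒adjacent F⊆H p∈ covered with find covered
  ... | E , E∈F , p⊆E = edge⇒adjacent p∈ (All.lookup F⊆H E∈F) p⊆E

  #Covered≤adjacent : ∀ {F} → All Edge F → #Covered F ≤ pairsAt d 1
  #Covered≤adjacent {F} F⊆H = count-mono (covered? F) (λ p → δ p ≟ℕ 1) (covered⇒adjacent F⊆H)

  ∣∪∣≡4+m⇒∣─∣≡m : ∀ {X Y m} → Edge X → ∣ Y ∪ X ∣ ≡ 4 + m → ∣ Y ─ X ∣ ≡ m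
  ∣∪∣≡4+m⇒∣─∣≡m {X} {Y} X∈ ∣Y∪X∣≡ =
    +-cancelˡ-≡ 4 _ _ (trans (cong (_+ ∣ Y ─ X ∣) (sym (∣edge∣≡4 X∈))) (trans (sym (∣p∪q∣≡∣q∣+∣p─q∣ Y X)) ∣Y∪X∣≡))

  5≤∣∪∣ : ∀ {X Y} → Edge X → Edge Y → Y ≢ X → 5 ≤ ∣ Y ∪ X ∣
  5≤∣∪∣ {X} {Y} X∈ Y∈ Y≢X = begin
    4 + 1              ≤⟨ +-mono-≤ (≤-reflexive (sym (∣edge∣≡4 X∈)))
                                   (Nonempty⇒1≤∣p∣ (distinct⇒Nonempty─ X (∣edge∣≡4 X∈) Y (∣edge∣≡4 Y∈) Y≢X)) ⟩
    ∣ X ∣ + ∣ Y ─ X ∣  ≡⟨ sym (∣p∪q∣≡∣q∣+∣p─q∣ Y X) ⟩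
    ∣ Y ∪ X ∣          ∎
    where open ≤-Reasoning

  d≤2-through : ∀ {u w E F} → Edge E → Edge F → u ∈ E → w ∈ F → Nonempty (E ∩ F) → d u w ≤ 2
  d≤2-through {E = E} {F} E∈ F∈ u∈E w∈F (t , t∈E∩F) =
    let t∈E , t∈F = x∈p∩q⁻ E F t∈E∩F
    in  d≤length (step (E , E∈ , u∈E , t∈E) (step (F , F∈ , t∈F , w∈F) here))

  far⇒Empty∩ : ∀ {u w E F} → 3 ≤ d u w → Edge E → Edge F → u ∈ E → w ∈ F → Empty (E ∩ F)
  far⇒Empty∩ 3≤d E∈ F∈ u∈E w∈F nonempty with ≤-trans 3≤d (d≤2-through E∈ F∈ u∈E w∈F nonempty)
  ... | s≤s (s≤s ())

  d≤3-through-disjoint : ∀ {u w E F} → Edge E → Edge F → u ∈ E → w ∈ F → Empty (E ∩ F) → d u w ≤ 3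
  d≤3-through-disjoint {E = E} {F} E∈ F∈ u∈E w∈F empty =
    let F≡∁E = Empty∩⇒≡∁ E (∣edge∣≡4 E∈) F (∣edge∣≡4 F∈) empty
        C , C∈ , C∉EF = edge-avoiding (E ∷ F ∷ []) (s≤s (s≤s (s≤s z≤n)))
        s , s∈E∩C = ≢∁⇒Nonempty∩ E (∣edge∣≡4 E∈) C (∣edge∣≡4 C∈) (λ C≡∁E → C∉EF (there (here (trans C≡∁E (sym F≡∁E)))))
        t , t∈C─E = distinct⇒Nonempty─ E (∣edge∣≡4 E∈) C (∣edge∣≡4 C∈) (C∉EF ∘ here)
        s∈E , s∈C = x∈p∩q⁻ E C s∈E∩C
        t∈F = subst (t ∈_) (sym F≡∁E) (x∉p⇒x∈∁p (x∈p─q⇒x∉q C E t∈C─E))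
    in  d≤length (step (E , E∈ , u∈E , s∈E) (step (C , C∈ , s∈C , p─q⊆p C E t∈C─E) (step (F , F∈ , t∈F , w∈F) here)))

  d≤3 : ∀ u w → d u w ≤ 3
  d≤3 u w with edge-through u | edge-through w
  ... | E , E∈ , u∈E | F , F∈ , w∈F with nonempty? (E ∩ F)
  ... | yes nonempty = ≤-trans (d≤2-through E∈ F∈ u∈E w∈F nonempty) (n≤1+n 2)
  ... | no  empty    = d≤3-through-disjoint E∈ F∈ u∈E w∈F empty

  distance-range : ∀ {p} → p ∈ₗ pairs 8 → 1 ≤ δ p × δ p ≤ 3
  distance-range {u , w} p∈ = 1≤d (<⇒≢ (∈-pairs⁻ p∈)) , d≤3 u w

  extend : ∀ F → ∣ ⋃ F ∣ < 8 → ∃ λ Z → Edge Z × 1 ≤ ∣ Z ─ ⋃ F ∣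
  extend F ∣⋃F∣<8 =
    let x , x∉⋃F = ∣p∣<n⇒∃∉ ∣⋃F∣<8
        Z , Z∈ , x∈Z = edge-through x
    in  Z , Z∈ , Nonempty⇒1≤∣p∣ (x , x∈p∧x∉q⇒x∈p─q x∈Z x∉⋃F)

  -- Q ∪ P misses a single vertex z, lying in some edge R. The pairs covered by Q or P (at least 12),
  -- the pairs of R through z (at least 3) and a pair of a fourth edge D avoiding all of these are
  -- adjacent and pairwise distinct.
  module Tight {P Q R D : Subset 8} {z : Fin 8} (P∈ : Edge P) (Q∈ : Edge Q) (R∈ : Edge R) (D∈ : Edge D)
               (D∉PQR : D ∉ₗ P ∷ Q ∷ R ∷ []) (∣Q∪P∣≡7 : ∣ Q ∪ P ∣ ≡ 7) (z∉Q∪P : z ∉ Q ∪ P) (z∈R : z ∈ R) where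

    Old : Pred (Pair 8) 0ℓ
    Old p = Covered (Q ∷ P ∷ []) p ⊎ (p ⊆ᵖ R × z ∈ᵖ p)

    old? : Decidable Old
    old? p = covered? (Q ∷ P ∷ []) p ⊎-dec ((p ⊆ᵖ? R) ×-dec z ∈ᵖ? p)

    New : Pred (Pair 8) 0ℓ
    New p = p ⊆ᵖ D × ¬ Old p

    new? : Decidable New
    new? p = (p ⊆ᵖ? D) ×-dec ¬? (old? p)

    New-swap : ∀ {a b} → New (a , b) → New (b , a)
    New-swap (ab⊆D , ¬old) = Product.swap ab⊆D , ¬old ∘ Sum.map (Any.map Product.swap) (Product.map Product.swap Sum.swap)

    15≤#Old : 15 ≤ count old? (pairs 8)
    15≤#Old = begin
      12 + 3                                                                  ≤⟨ +-mono-≤ 12≤#Covered (3≤pairs-through R (∣edge∣≡4 R∈) z z∈R) ⟩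
      #Covered (Q ∷ P ∷ []) + count (λ p → (p ⊆ᵖ? R) ×-dec z ∈ᵖ? p) (pairs 8) ≡⟨ count-∪ (covered? (Q ∷ P ∷ [])) (λ p → (p ⊆ᵖ? R) ×-dec z ∈ᵖ? p) disjoint (pairs 8) ⟩
      count old? (pairs 8)                                                    ∎
      where
      open ≤-Reasoning
      12≤#Covered : 12 ≤ #Covered (Q ∷ P ∷ [])
      12≤#Covered = subst (λ m → 6 + φ m ≤ #Covered (Q ∷ P ∷ [])) (∣∪∣≡4+m⇒∣─∣≡m {Y = Q} P∈ ∣Q∪P∣≡7) (#Covered-pair {P} {Q} (∣edge∣≡4 P∈) (∣edge∣≡4 Q∈))
      disjoint : ∀ {p} → Covered (Q ∷ P ∷ []) p → ¬ (p ⊆ᵖ R × z ∈ᵖ p)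
      disjoint covered (_ , z∈p) with Covered⇒⊆ᵖ⋃ covered | z∈p
      ... | u∈ , _ | inj₁ refl = z∉Q∪P (subst (z ∈_) (⋃-pair P Q) u∈)
      ... | _ , w∈ | inj₂ refl = z∉Q∪P (subst (z ∈_) (⋃-pair P Q) w∈)

    1≤#New : 1 ≤ count new? (pairs 8)
    1≤#New with escaping-pair (∣edge∣≡4 P∈) (∣edge∣≡4 Q∈) (∣edge∣≡4 R∈) (∣edge∣≡4 D∈)
                  (D∉PQR ∘ here) (D∉PQR ∘ there ∘ here) (D∉PQR ∘ there ∘ there ∘ here) ∣Q∪P∣≡7 z∉Q∪P z∈R
    ... | a , b , a≢b , ab⊆D , ¬⊆P , ¬⊆Q , ¬through =
      filter-some new? {pairs 8} (Sum.[ (λ ab∈ → lose ab∈ new) , (λ ba∈ → lose ba∈ (New-swap new)) ] (∈-pairs-ordered a≢b))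
      where
      new : New (a , b)
      new = ab⊆D , Sum.[ (λ { (here ⊆Q) → ¬⊆Q ⊆Q ; (there (here ⊆P)) → ¬⊆P ⊆P }) , ¬through ]

    16≤adjacent : 16 ≤ pairsAt d 1
    16≤adjacent = begin
      15 + 1                                      ≤⟨ +-mono-≤ 15≤#Old 1≤#New ⟩
      count old? (pairs 8) + count new? (pairs 8) ≡⟨ count-∪ old? new? (λ old new → proj₂ new old) (pairs 8) ⟩
      count (old? ∪? new?) (pairs 8)              ≤⟨ count-mono (old? ∪? new?) (λ p → δ p ≟ℕ 1) adjacent ⟩
      pairsAt d 1                                 ∎
      where
      open ≤-Reasoning
      adjacent : ∀ {p} → p ∈ₗ pairs 8 → Old p ⊎ New p → δ p ≡ 1
      adjacent p∈ (inj₁ (inj₁ covered))   = covered⇒adjacent (Q∈ ∷ P∈ ∷ []) p∈ covered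
      adjacent p∈ (inj₁ (inj₂ (p⊆R , _))) = edge⇒adjacent p∈ R∈ p⊆R
      adjacent p∈ (inj₂ (p⊆D , _))        = edge⇒adjacent p∈ D∈ p⊆D

  16≤adjacent-if-∣∪∣≡7 : ∀ {P Q} → Edge P → Edge Q → ∣ Q ∪ P ∣ ≡ 7 → 16 ≤ pairsAt d 1
  16≤adjacent-if-∣∪∣≡7 {P} {Q} P∈ Q∈ ∣Q∪P∣≡7 =
    let z , z∉Q∪P = ∣p∣<n⇒∃∉ (≤-reflexive (cong suc ∣Q∪P∣≡7))
        R , R∈ , z∈R = edge-through z
        D , D∈ , D∉PQR = edge-avoiding (P ∷ Q ∷ R ∷ []) ≤-refl
    in  Tight.16≤adjacent P∈ Q∈ R∈ D∈ D∉PQR ∣Q∪P∣≡7 z∉Q∪P z∈R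

  16≤adjacent-from-7 : ∀ {F} → All Edge F → ∣ ⋃ F ∣ ≡ 7 → 13 ≤ #Covered F → 16 ≤ pairsAt d 1
  16≤adjacent-from-7 {F} F⊆H ∣⋃F∣≡7 13≤#F =
    let Z , Z∈ , 1≤∣Z─⋃F∣ = extend F (≤-reflexive (cong suc ∣⋃F∣≡7))
    in  begin
      13 + 3                      ≤⟨ +-mono-≤ 13≤#F (3≤φ 1≤∣Z─⋃F∣) ⟩
      #Covered F + φ ∣ Z ─ ⋃ F ∣  ≤⟨ #Covered-∷ Z F (∣edge∣≡4 Z∈) ⟩
      #Covered (Z ∷ F)            ≤⟨ #Covered≤adjacent (Z∈ ∷ F⊆H) ⟩
      pairsAt d 1                 ∎
    where open ≤-Reasoning

  16≤adjacent-from-6 : ∀ {F} → All Edge F → ∣ ⋃ F ∣ ≡ 6 → 11 ≤ #Covered F → 16 ≤ pairsAt d 1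
  16≤adjacent-from-6 {F} F⊆H ∣⋃F∣≡6 11≤#F with extend F (subst (_< 8) (sym ∣⋃F∣≡6) (m≤m+n 7 1))
  -- No clause for ∣ Z ─ ⋃ F ∣ = 0 is needed: `1≤m` is abstracted to `1 ≤ 0` there.
  ... | Z , Z∈ , 1≤m with ∣ Z ─ ⋃ F ∣ | #Covered-∷ Z F (∣edge∣≡4 Z∈) | ∣p∪q∣≡∣q∣+∣p─q∣ Z (⋃ F)
  ... | 1 | grows | ∣⋃∷∣≡ =
    16≤adjacent-from-7 (Z∈ ∷ F⊆H) (trans ∣⋃∷∣≡ (cong (_+ 1) ∣⋃F∣≡6)) (≤-trans (n≤1+n 13) (≤-trans (+-monoˡ-≤ 3 11≤#F) grows))
  ... | suc (suc m) | grows | _ =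
    ≤-trans (≤-trans (+-mono-≤ 11≤#F (5≤φ (s≤s (s≤s z≤n)))) grows) (#Covered≤adjacent (Z∈ ∷ F⊆H))

  -- Z holds the three vertices outside Y ∪ X, so Z ∪ X misses at most one vertex; if it misses none,
  -- then Z = ∁ X and Z ∪ Y misses exactly one.
  16≤adjacent-from-5+3 : ∀ {X Y Z} → Edge X → Edge Y → Edge Z → ∣ Y ∪ X ∣ ≡ 5 → ∣ Z ─ ⋃ (Y ∷ X ∷ []) ∣ ≡ 3 →
                         16 ≤ pairsAt d 1
  16≤adjacent-from-5+3 {X} {Y} {Z} X∈ Y∈ Z∈ ∣Y∪X∣≡5 ∣Z─⋃F∣≡3 with ∣ Z ∪ X ∣ ≟ℕ 8
  ... | yes ∣Z∪X∣≡8 = 16≤adjacent-if-∣∪∣≡7 Y∈ Z∈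
        (subst (λ W → ∣ W ∪ Y ∣ ≡ 7) (sym Z≡∁X) (∣∪∣≡5⇒∣∁∪∣≡7 X (∣edge∣≡4 X∈) Y (∣edge∣≡4 Y∈) ∣Y∪X∣≡5))
    where Z≡∁X = ∣∪∣≡8⇒≡∁ X (∣edge∣≡4 X∈) Z (∣edge∣≡4 Z∈) ∣Z∪X∣≡8
  ... | no ∣Z∪X∣≢8 = 16≤adjacent-if-∣∪∣≡7 X∈ Z∈ (≤-antisym (s≤s⁻¹ (≤∧≢⇒< (∣p∣≤n (Z ∪ X)) ∣Z∪X∣≢8)) 7≤∣Z∪X∣)
    where
    7≤∣Z∪X∣ : 7 ≤ ∣ Z ∪ X ∣
    7≤∣Z∪X∣ = begin
      4 + 3                          ≡⟨ cong₂ _+_ (sym (∣edge∣≡4 X∈)) (sym ∣Z─⋃F∣≡3) ⟩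
      ∣ X ∣ + ∣ Z ─ ⋃ (Y ∷ X ∷ []) ∣ ≤⟨ +-monoʳ-≤ ∣ X ∣ (p⊆q⇒∣p∣≤∣q∣ (─-antimonoʳ {p = Z} {X} {⋃ (Y ∷ X ∷ [])}
                                          (λ x∈X → ∈⋃⁺ {F = Y ∷ X ∷ []} x∈X (there (here refl))))) ⟩
      ∣ X ∣ + ∣ Z ─ X ∣              ≡⟨ sym (∣p∪q∣≡∣q∣+∣p─q∣ Z X) ⟩
      ∣ Z ∪ X ∣                      ∎
      where open ≤-Reasoning

  16≤adjacent-from-5 : ∀ {X Y} → Edge X → Edge Y → ∣ Y ∪ X ∣ ≡ 5 → 16 ≤ pairsAt d 1
  16≤adjacent-from-5 {X} {Y} X∈ Y∈ ∣Y∪X∣≡5 = grow (trans (cong ∣_∣ (⋃-pair X Y)) ∣Y∪X∣≡5)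
    where
    F = Y ∷ X ∷ []
    9≤#F : 9 ≤ #Covered F
    9≤#F = subst (λ m → 6 + φ m ≤ #Covered F) (∣∪∣≡4+m⇒∣─∣≡m {Y = Y} X∈ ∣Y∪X∣≡5) (#Covered-pair {X} {Y} (∣edge∣≡4 X∈) (∣edge∣≡4 Y∈))
    grow : ∣ ⋃ F ∣ ≡ 5 → 16 ≤ pairsAt d 1
    grow ∣⋃F∣≡5 with extend F (subst (_< 8) (sym ∣⋃F∣≡5) (m≤m+n 6 2))
    ... | Z , Z∈ , 1≤m with ∣ Z ─ ⋃ F ∣ in ∣Z─⋃F∣≡ | #Covered-∷ Z F (∣edge∣≡4 Z∈) | ∣p∪q∣≡∣q∣+∣p─q∣ Z (⋃ F)
    ... | 1 | grows | ∣⋃∷∣≡ = 16≤adjacent-from-6 (Z∈ ∷ Y∈ ∷ X∈ ∷ []) (trans ∣⋃∷∣≡ (cong (_+ 1) ∣⋃F∣≡5))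
                                 (≤-trans (n≤1+n 11) (≤-trans (+-monoˡ-≤ 3 9≤#F) grows))
    ... | 2 | grows | ∣⋃∷∣≡ = 16≤adjacent-from-7 (Z∈ ∷ Y∈ ∷ X∈ ∷ []) (trans ∣⋃∷∣≡ (cong (_+ 2) ∣⋃F∣≡5))
                                 (≤-trans (n≤1+n 13) (≤-trans (+-monoˡ-≤ 5 9≤#F) grows))
    ... | 3 | _ | _ = 16≤adjacent-from-5+3 X∈ Y∈ Z∈ ∣Y∪X∣≡5 ∣Z─⋃F∣≡
    ... | suc (suc (suc (suc m))) | _ | ∣⋃∷∣≡ =
      contradiction (+-cancelˡ-≤ 8 (suc m) 0 (subst (_≤ 8) (trans ∣⋃∷∣≡ (cong (_+ _) ∣⋃F∣≡5)) (∣p∣≤n (Z ∪ ⋃ F)))) λ ()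

  16≤adjacent-from-pair : ∀ {X Y} → Edge X → Edge Y → Y ≢ X → Y ≢ ∁ X → 16 ≤ pairsAt d 1
  16≤adjacent-from-pair {X} {Y} X∈ Y∈ Y≢X Y≢∁X
    with ∣ Y ─ X ∣ in ∣Y─X∣≡ | ∣p∪q∣≡∣q∣+∣p─q∣ Y X | Nonempty⇒1≤∣p∣ (distinct⇒Nonempty─ X (∣edge∣≡4 X∈) Y (∣edge∣≡4 Y∈) Y≢X)
  ... | 1 | ∣Y∪X∣≡ | _ = 16≤adjacent-from-5 X∈ Y∈ (trans ∣Y∪X∣≡ (cong (_+ 1) (∣edge∣≡4 X∈)))
  ... | 2 | ∣Y∪X∣≡ | _ = 16≤adjacent-from-6 (Y∈ ∷ X∈ ∷ [])
        (trans (cong ∣_∣ (⋃-pair X Y)) (trans ∣Y∪X∣≡ (cong (_+ 2) (∣edge∣≡4 X∈))))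
        (subst (λ m → 6 + φ m ≤ #Covered (Y ∷ X ∷ [])) ∣Y─X∣≡ (#Covered-pair {X} {Y} (∣edge∣≡4 X∈) (∣edge∣≡4 Y∈)))
  ... | 3 | ∣Y∪X∣≡ | _ = 16≤adjacent-if-∣∪∣≡7 X∈ Y∈ (trans ∣Y∪X∣≡ (cong (_+ 3) (∣edge∣≡4 X∈)))
  ... | 4 | ∣Y∪X∣≡ | _ =
    contradiction (∣∪∣≡8⇒≡∁ X (∣edge∣≡4 X∈) Y (∣edge∣≡4 Y∈) (trans ∣Y∪X∣≡ (cong (_+ 4) (∣edge∣≡4 X∈)))) Y≢∁X
  ... | suc (suc (suc (suc (suc m)))) | ∣Y∪X∣≡ | _ =
    contradiction (+-cancelˡ-≤ 8 (suc m) 0 (subst (_≤ 8) (trans ∣Y∪X∣≡ (cong (_+ _) (∣edge∣≡4 X∈))) (∣p∣≤n (Y ∪ X)))) λ ()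

  16≤adjacent : 16 ≤ pairsAt d 1
  16≤adjacent =
    let X , X∈ , _  = edge-avoiding [] (s≤s z≤n)
        Y , Y∈ , Y∉ = edge-avoiding (X ∷ ∁ X ∷ []) (s≤s (s≤s (s≤s z≤n)))
    in  16≤adjacent-from-pair X∈ Y∈ (Y∉ ∘ here) (Y∉ ∘ there ∘ here)

  module FarPair {u₀ w₀ A B} (far : 3 ≤ d u₀ w₀) (A∈ : Edge A) (B∈ : Edge B) (u₀∈A : u₀ ∈ A) (w₀∈B : w₀ ∈ B) where

    B≡∁A : B ≡ ∁ A
    B≡∁A = Empty∩⇒≡∁ A (∣edge∣≡4 A∈) B (∣edge∣≡4 B∈) (far⇒Empty∩ far A∈ B∈ u₀∈A w₀∈B)

    through-u₀ : ∀ {E} → Edge E → u₀ ∈ E → E ≡ A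
    through-u₀ E∈ u₀∈E = trans (≡∁B E∈ u₀∈E) (sym (≡∁B A∈ u₀∈A))
      where
      ≡∁B : ∀ {E} → Edge E → u₀ ∈ E → E ≡ ∁ B
      ≡∁B E∈ u₀∈E = Empty∩⇒≡∁ _ (∣edge∣≡4 B∈) _ (∣edge∣≡4 E∈) (Empty-∩-comm (far⇒Empty∩ far E∈ B∈ u₀∈E w₀∈B))

    disjoint⇒A⊎B : ∀ {E F} → Edge E → Edge F → Empty (E ∩ F) → E ≡ A ⊎ E ≡ B
    disjoint⇒A⊎B {E} {F} E∈ F∈ empty with u₀ ∈? E
    ... | yes u₀∈E = inj₁ (through-u₀ E∈ u₀∈E)
    ... | no  u₀∉E = inj₂ (trans (Empty∩⇒≡∁ A (∣edge∣≡4 A∈) E (∣edge∣≡4 E∈) A∩E=∅) (sym B≡∁A))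
      where
      F≡A : F ≡ A
      F≡A = through-u₀ F∈ (subst (u₀ ∈_) (sym (Empty∩⇒≡∁ E (∣edge∣≡4 E∈) F (∣edge∣≡4 F∈) empty)) (x∉p⇒x∈∁p u₀∉E))
      A∩E=∅ : Empty (A ∩ E)
      A∩E=∅ = subst (λ W → Empty (W ∩ E)) F≡A (Empty-∩-comm empty)

    OnlyInAB : Pred (Fin 8) 0ℓ
    OnlyInAB x = All (λ E → x ∈ E → E ≡ A ⊎ E ≡ B) (edges H)

    onlyInAB? : Decidable OnlyInAB
    onlyInAB? x = All.all? (λ E → x ∈? E →-dec (E ≟ˢ A ⊎-dec E ≟ˢ B)) (edges H)

    T : Subset 8
    T = subsetOf onlyInAB?

    ∉T : ∀ {x E} → Edge E → E ≢ A → E ≢ B → x ∈ E → x ∉ T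
    ∉T E∈ E≢A E≢B x∈E x∈T = Sum.[ E≢A , E≢B ] (All.lookup (∈-subsetOf⁻ onlyInAB? x∈T) E∈ x∈E)

    ∣T∣≤3 : ∣ T ∣ ≤ 3
    ∣T∣≤3 =
      let C , C∈ , C∉AB  = edge-avoiding (A ∷ B ∷ []) (s≤s (s≤s (s≤s z≤n)))
          D , D∈ , D∉ABC = edge-avoiding (A ∷ B ∷ C ∷ []) ≤-refl
          T⊆∁[D∪C] : T ⊆ ∁ (D ∪ C)
          T⊆∁[D∪C] x∈T = x∉p⇒x∈∁p (Sum.[ (λ x∈D → ∉T D∈ (D∉ABC ∘ here) (D∉ABC ∘ there ∘ here) x∈D x∈T)
                                       , (λ x∈C → ∉T C∈ (C∉AB ∘ here) (C∉AB ∘ there ∘ here) x∈C x∈T) ] ∘ x∈p∪q⁻ D C)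
      in  begin
        ∣ T ∣              ≤⟨ p⊆q⇒∣p∣≤∣q∣ T⊆∁[D∪C] ⟩
        ∣ ∁ (D ∪ C) ∣      ≡⟨ ∣∁p∣≡n∸∣p∣ (D ∪ C) ⟩
        8 ∸ ∣ D ∪ C ∣      ≤⟨ ∸-monoʳ-≤ 8 (5≤∣∪∣ C∈ D∈ (D∉ABC ∘ there ∘ there ∘ here)) ⟩
        3                  ∎
      where open ≤-Reasoning

    far⇒OnlyInAB : ∀ {x y} → 3 ≤ d x y → OnlyInAB x × OnlyInAB y
    far⇒OnlyInAB {x} {y} 3≤d =
      let Ex , Ex∈ , x∈Ex = edge-through x
          Ey , Ey∈ , y∈Ey = edge-through y
      in  All.tabulate (λ E∈ x∈E → disjoint⇒A⊎B E∈ Ey∈ (far⇒Empty∩ 3≤d E∈ Ey∈ x∈E y∈Ey)) ,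
          All.tabulate (λ E∈ y∈E → disjoint⇒A⊎B E∈ Ex∈ (Empty-∩-comm (far⇒Empty∩ 3≤d Ex∈ E∈ x∈Ex y∈E)))

    split : ∀ {x y E F} → Empty (E ∩ F) → x ∈ E → y ∈ F → E ≡ A ⊎ E ≡ B → F ≡ A ⊎ F ≡ B → Split A (x , y)
    split empty x∈E y∈F (inj₁ refl) (inj₂ refl) = inj₁ (x∈E , subst (_ ∈_) B≡∁A y∈F)
    split empty x∈E y∈F (inj₂ refl) (inj₁ refl) = inj₂ (subst (_ ∈_) B≡∁A x∈E , y∈F)
    split empty x∈E y∈F (inj₁ refl) (inj₁ refl) = contradiction (_ , x∈p∩q⁺ (x∈E , x∈E)) empty
    split empty x∈E y∈F (inj₂ refl) (inj₂ refl) = contradiction (_ , x∈p∩q⁺ (x∈E , x∈E)) empty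

    far⇒Split : ∀ {x y} → 3 ≤ d x y → Split A (x , y)
    far⇒Split {x} {y} 3≤d =
      let Ex , Ex∈ , x∈Ex = edge-through x
          Ey , Ey∈ , y∈Ey = edge-through y
          empty = far⇒Empty∩ 3≤d Ex∈ Ey∈ x∈Ex y∈Ey
      in  split empty x∈Ex y∈Ey (disjoint⇒A⊎B Ex∈ Ey∈ empty) (disjoint⇒A⊎B Ey∈ Ex∈ (Empty-∩-comm empty))

    far≤split : pairsAt d 3 ≤ count (λ p → (p ⊆ᵖ? T) ×-dec split? A p) (pairs 8)
    far≤split = count-mono (λ p → δ p ≟ℕ 3) (λ p → (p ⊆ᵖ? T) ×-dec split? A p) {pairs 8} λ { {x , y} _ d≡3 →
      let 3≤d = ≤-reflexive (sym d≡3)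
          onlyx , onlyy = far⇒OnlyInAB 3≤d
      in  (∈-subsetOf⁺ onlyInAB? onlyx , ∈-subsetOf⁺ onlyInAB? onlyy) , far⇒Split 3≤d }

    adjacent≤near : pairsAt d 1 ≤ count (λ p → (p ⊆ᵖ? A) ⊎-dec (p ⊆ᵖ? ∁ A) ⊎-dec (p ⊆ᵖ? ∁ T)) (pairs 8)
    adjacent≤near = count-mono (λ p → δ p ≟ℕ 1) (λ p → (p ⊆ᵖ? A) ⊎-dec (p ⊆ᵖ? ∁ A) ⊎-dec (p ⊆ᵖ? ∁ T)) {pairs 8}
                               λ { {x , y} _ d≡1 → near (d≡1⇒Adj d≡1) }
      where
      near : ∀ {x y} → Adj H x y → (x , y) ⊆ᵖ A ⊎ (x , y) ⊆ᵖ ∁ A ⊎ (x , y) ⊆ᵖ ∁ T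
      near (E , E∈ , x∈E , y∈E) with E ≟ˢ A | E ≟ˢ B
      ... | yes refl | _        = inj₁ (x∈E , y∈E)
      ... | no _     | yes refl = inj₂ (inj₁ (subst (_ ∈_) B≡∁A x∈E , subst (_ ∈_) B≡∁A y∈E))
      ... | no E≢A   | no E≢B   = inj₂ (inj₂ (x∉p⇒x∈∁p (∉T E∈ E≢A E≢B x∈E) , x∉p⇒x∈∁p (∉T E∈ E≢A E≢B y∈E)))

    far≤2 : pairsAt d 3 ≤ 2
    far≤2 = ≤-trans far≤split (proj₁ (split-pairs-bound A (∣edge∣≡4 A∈) T ∣T∣≤3))

    adjacent≤18 : 2 ≤ pairsAt d 3 → pairsAt d 1 ≤ 18
    adjacent≤18 2≤far = ≤-trans adjacent≤near (proj₂ (split-pairs-bound A (∣edge∣≡4 A∈) T ∣T∣≤3) (≤-trans 2≤far far≤split))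

  far-pair-bounds : 1 ≤ pairsAt d 3 → pairsAt d 3 ≤ 2 × (2 ≤ pairsAt d 3 → pairsAt d 1 ≤ 18)
  far-pair-bounds 1≤far with find (1≤count⇒Any (λ p → δ p ≟ℕ 3) (pairs 8) 1≤far)
  ... | (u , w) , _ , d≡3 =
    let A , A∈ , u∈A = edge-through u
        B , B∈ , w∈B = edge-through w
        open FarPair (≤-reflexive (sym d≡3)) A∈ B∈ u∈A w∈B
    in  far≤2 , adjacent≤18

  far-pairs≤2 : pairsAt d 3 ≤ 2
  far-pairs≤2 with 1 ≤? pairsAt d 3
  ... | no  ¬1≤far = ≤-trans (s≤s⁻¹ (≰⇒> ¬1≤far)) z≤n
  ... | yes 1≤far  = proj₁ (far-pair-bounds 1≤far)

  two-far-pairs⇒adjacent≤18 : pairsAt d 3 ≡ 2 → pairsAt d 1 ≤ 18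
  two-far-pairs⇒adjacent≤18 far≡2 = proj₂ (far-pair-bounds (≤-trans (s≤s z≤n) 2≤far)) 2≤far
    where 2≤far = ≤-reflexive (sym far≡2)

  -- W = c₁ + 2c₂ + 3c₃ with c₁ + c₂ + c₃ = 28 pairs.
  wiener+adjacent : wiener d + pairsAt d 1 ≡ 56 + pairsAt d 3
  wiener+adjacent = sum-of-values-in-1…3 δ (All.tabulate distance-range)

  wiener≤40+far : wiener d ≤ 40 + pairsAt d 3
  wiener≤40+far = +-cancelʳ-≤ 16 (wiener d) (40 + pairsAt d 3) (begin
    wiener d + 16           ≤⟨ +-monoʳ-≤ (wiener d) 16≤adjacent ⟩
    wiener d + pairsAt d 1  ≡⟨ wiener+adjacent ⟩
    56 + pairsAt d 3        ≡⟨ +-comm 16 (40 + pairsAt d 3) ⟩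
    40 + pairsAt d 3 + 16   ∎)
    where open ≤-Reasoning

  38+far≤wiener : pairsAt d 1 ≤ 18 → 38 + pairsAt d 3 ≤ wiener d
  38+far≤wiener adjacent≤18 = +-cancelʳ-≤ 18 (38 + pairsAt d 3) (wiener d) (begin
    38 + pairsAt d 3 + 18   ≡⟨ +-comm (38 + pairsAt d 3) 18 ⟩
    56 + pairsAt d 3        ≡⟨ wiener+adjacent ⟨
    wiener d + pairsAt d 1  ≤⟨ +-monoʳ-≤ (wiener d) adjacent≤18 ⟩
    wiener d + 18           ∎)
    where open ≤-Reasoning

  diameter≤2 : pairsAt d 3 ≡ 0 → diameter d ≤ 2
  diameter≤2 no-far = foldr-⊔-lub δ (All.tabulate λ p∈ →
    s≤s⁻¹ (≤∧≢⇒< (proj₂ (distance-range p∈)) (All.lookup (count≡0⇒All∁ (λ p → δ p ≟ℕ 3) (pairs 8) no-far) p∈)))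

  diameter≡3 : 1 ≤ pairsAt d 3 → diameter d ≡ 3
  diameter≡3 1≤far with find (1≤count⇒Any (λ p → δ p ≟ℕ 3) (pairs 8) 1≤far)
  ... | p , p∈ , δp≡3 = ≤-antisym (foldr-⊔-lub δ (All.tabulate (proj₂ ∘ distance-range)))
                                  (subst (_≤ diameter d) δp≡3 (foldr-⊔-upper δ p∈))

≤2-cases : ∀ {n} → n ≤ 2 → n ≡ 0 ⊎ n ≡ 1 ⊎ n ≡ 2
≤2-cases z≤n             = inj₁ refl
≤2-cases (s≤s z≤n)       = inj₂ (inj₁ refl)
≤2-cases (s≤s (s≤s z≤n)) = inj₂ (inj₂ refl)

mainTheorem12 : (H : Hypergraph 8) → Connected H → Uniform 4 H → 4 ≤ numEdges H →
    (d : Fin 8 → Fin 8 → ℕ) → IsDistance H d →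
      (diameter d ≤ 2 × wiener d ≤ 40)
      ⊎ (diameter d ≡ 3 × wiener d ≤ 41 × pairsAt d 3 ≡ 1)
      ⊎ (diameter d ≡ 3 × 40 ≤ wiener d × wiener d ≤ 42 × pairsAt d 3 ≡ 2)
mainTheorem12 H connected uniform four d isDistance =
  let open Bounds H connected uniform four isDistance in
  Sum.map (λ far≡0 → diameter≤2 far≡0 , subst (λ c → wiener d ≤ 40 + c) far≡0 wiener≤40+far)
  (Sum.map (λ far≡1 → diameter≡3 (≤-reflexive (sym far≡1)) , subst (λ c → wiener d ≤ 40 + c) far≡1 wiener≤40+far , far≡1)
           (λ far≡2 → diameter≡3 (≤-trans (s≤s z≤n) (≤-reflexive (sym far≡2))) ,
                      subst (λ c → 38 + c ≤ wiener d) far≡2 (38+far≤wiener (two-far-pairs⇒adjacent≤18 far≡2)) ,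
                      subst (λ c → wiener d ≤ 40 + c) far≡2 wiener≤40+far , far≡2))
  (≤2-cases far-pairs≤2)
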